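{- Consider Algorithm 5 below, run with a value $\mathsf{opt}_2$ satisfying $f(OPT)/2\le\mathsf{opt}_2\le f(OPT)$. If its output $S$ satisfies $|S|\le\max\{0,k-d-1\}$, then $f(S)\ge f(OPT)/2$.
   Context: $\mathcal N$ is a finite ground set, $f:2^{\mathcal N}\to\mathbb R_{\ge0}$ is a monotone set function with $f(\varnothing)=0$, and the constraint is the uniform matroid of rank $k$ (a set is feasible iff it has at most $k$ elements); $OPT$ is a feasible set maximizing $f$. $f(u\mid S)=f(S\cup\{u\})-f(S)$. $\mathcal D^+(u)=\{v\in\mathcal N:\exists S\subseteq\mathcal N,\ f(u\mid S\cup\{v\})>f(u\mid S)\}$ and $d=\max_u|\mathcal D^+(u)|$. Elements arrive in some order; $\mathcal N_u$ is the set of elements arriving up to and including $u$. Algorithm 5: set $\tau=\mathsf{opt}_2/(2k)$ and $S=\varnothing$; for each arriving element $u$, if there is a set $D\subseteq\mathcal D^+(u)\setminus\mathcal N_u$ with $f(u\mid D\cup S)\ge\tau$ and $|S|+|D|+1\le k$, add $D\cup\{u\}$ to $S$; return $S$.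
   Formalization: The set function f takes nonnegative rational values rather than real ones, and the value $\mathsf{opt}_2$ is rational. -}

module Defs where

open import Data.Nat as ℕ using (ℕ; zero; suc; NonZero; _⊔_)
open import Data.Integer using (+_)
open import Data.Rational using (ℚ; _+_; _*_; _-_; _/_; _≤_; _<_; 0ℚ)
open import Data.Fin using (Fin)
open import Data.Fin.Subset using (Subset; _∈_; _∉_; _⊆_; _∪_; ⁅_⁆; ∣_∣; ⊥)
open import Data.List using (List; []; _∷_; foldr; allFin)
open import Data.Product using (Σ; ∃; _×_; _,_)
open import Relation.Nullary using (¬_)

marg : {n : ℕ} → (Subset n → ℚ) → Fin n → Subset n → ℚ
marg f u S = f (S ∪ ⁅ u ⁆) - f S

Monotone : {n : ℕ} → (Subset n → ℚ) → Set
Monotone {n} f = (A B : Subset n) → A ⊆ B → f A ≤ f B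

NonNegative : {n : ℕ} → (Subset n → ℚ) → Set
NonNegative {n} f = (A : Subset n) → 0ℚ ≤ f A

InDplus : {n : ℕ} → (Subset n → ℚ) → Fin n → Fin n → Set
InDplus {n} f u v = Σ (Subset n) λ S → marg f u S < marg f u (S ∪ ⁅ v ⁆)

IsDplus : {n : ℕ} → (Subset n → ℚ) → (Fin n → Subset n) → Set
IsDplus {n} f Dp = (u v : Fin n) → (v ∈ Dp u → InDplus f u v) × (InDplus f u v → v ∈ Dp u)

-- d = max_u |𝒟⁺(u)|  (0 for an empty ground set)
dmax : {n : ℕ} → (Fin n → Subset n) → ℕ
dmax {n} Dp = foldr (λ u m → ∣ Dp u ∣ ⊔ m) 0 (allFin n)

IsOPT : {n : ℕ} → (Subset n → ℚ) → ℕ → Subset n → Set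
IsOPT {n} f k O = (∣ O ∣ ℕ.≤ k) × ((T : Subset n) → ∣ T ∣ ℕ.≤ k → f T ≤ f O)

half : ℚ → ℚ
half x = (+ 1 / 2) * x

tau : ℚ → (k : ℕ) → .{{NonZero k}} → ℚ
tau o (suc k) = o * (+ 1 / (2 ℕ.* suc k))

-- The admissibility condition of Algorithm 5 for arriving element u,
-- current solution S, set Nu = 𝒩_u (arrived so far, including u), and candidate D:
-- D ⊆ 𝒟⁺(u) ∖ 𝒩_u, f(u ∣ D ∪ S) ≥ τ, |S| + |D| + 1 ≤ k.
Admissible : {n : ℕ} → (Subset n → ℚ) → ℕ → (Fin n → Subset n) → ℚ →
             Fin n → Subset n → Subset n → Subset n → Set
Admissible {n} f k Dp τ u Nu S D =
  (D ⊆ Dp u) × ((v : Fin n) → v ∈ D → v ∉ Nu) ×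
  (τ ≤ marg f u (D ∪ S)) × (∣ S ∣ ℕ.+ ∣ D ∣ ℕ.+ 1 ℕ.≤ k)

-- Executions of Algorithm 5 (the choice of D is nondeterministic).
-- Run f k Dp τ P σ S S' : starting with arrived-set P and current solution S,
-- processing the remaining arrival sequence σ can end with solution S'.
data Run {n : ℕ} (f : Subset n → ℚ) (k : ℕ) (Dp : Fin n → Subset n) (τ : ℚ) :
         Subset n → List (Fin n) → Subset n → Subset n → Set where
  done : ∀ {P S} → Run f k Dp τ P [] S S
  add  : ∀ {P u σ S S'} (D : Subset n) →
         Admissible f k Dp τ u (P ∪ ⁅ u ⁆) S D →
         Run f k Dp τ (P ∪ ⁅ u ⁆) σ (S ∪ (D ∪ ⁅ u ⁆)) S' →
         Run f k Dp τ P (u ∷ σ) S S'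
  skip : ∀ {P u σ S S'} →
         ¬ (Σ (Subset n) λ D → Admissible f k Dp τ u (P ∪ ⁅ u ⁆) S D) →
         Run f k Dp τ (P ∪ ⁅ u ⁆) σ S S' →
         Run f k Dp τ P (u ∷ σ) S S'

{-# OPTIONS --safe #-}
-- Write Unseen P = OPT ∖ P for the optimal elements not yet arrived once P has.  By
-- induction along the run, the final output S satisfies f (S ∪ Unseen P) ≤ f S + |Unseen P| · τ
-- at every stage P.  An arrival u costs something only if u ∈ OPT ∖ S was skipped; then the
-- marginal of u on W = S ∪ Unseen (P ∪ {u}) is below τ, for otherwise, with S₀ the solution at
-- the arrival of u, D = (W ∖ S₀) ∩ 𝒟⁺(u) would have been admissible: deleting elements outside
-- 𝒟⁺(u) never lowers the marginal of u, no element of D has arrived yet, and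
-- |S₀| + |D| + 1 ≤ |S| + |Unseen ∩ 𝒟⁺(u)| + 1 ≤ k by the bound on |S|.
-- At P = ∅ this gives f OPT ≤ f S + k τ = f S + opt₂ / 2 ≤ f S + f OPT / 2.
module Submission where

open import Defs
open import Data.Nat as ℕ using (ℕ; NonZero; _∸_)
open import Data.Rational using (ℚ; _≤_; 0ℚ)
open import Data.Fin using (Fin)
open import Data.Fin.Subset using (Subset; ∣_∣; ⊥)
open import Data.List using (List; allFin)
open import Data.List.Relation.Binary.Permutation.Propositional using (_↭_)
open import Relation.Binary.PropositionalEquality using (_≡_)

open import Algebra.Bundles using (CommutativeMonoid; CommutativeRing)
open import Data.Fin.Subset using (_∈_; _∉_; _⊆_; _⊂_; _⊃_; _∪_; _∩_; _─_; ⁅_⁆; inside; outside)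
open import Data.Fin.Subset.Induction using (Acc; acc; ⊃-wellFounded)
open import Data.Fin.Subset.Properties
  using (_∈?_; nonempty?; ∉⊥; drop-∷-⊆; ⊆-antisym; p⊆q⇒∣p∣≤∣q∣; p⊂q⇒∣p∣<∣q∣; ∣p∩q∣≤∣q∣;
         p⊆p∪q; q⊆p∪q; x∈p∪q⁻; p∩q⊆p; p∩q⊆q; x∈p∩q⁺; x∈p∩q⁻; x∈⁅x⁆; x∈⁅y⁆⇒x≡y;
         p─q⊆p; ∣p─q∣≤∣p∣; x∈p∧x∉q⇒x∈p─q)
open import Data.Integer as ℤ using (+_)
import Data.Integer.Properties as ℤ
open import Data.List using (foldr; []; _∷_)
open import Data.List.Membership.Propositional using () renaming (_∈_ to _∈ₗ_)
open import Data.List.Membership.Propositional.Properties using (∈-allFin)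
import Data.List.Relation.Unary.All as All
open import Data.List.Relation.Unary.AllPairs using (_∷_)
open import Data.List.Relation.Unary.Any using (here; there)
open import Data.List.Relation.Unary.Any.Properties using (¬Any[])
open import Data.List.Relation.Unary.Unique.Propositional using (Unique)
open import Data.List.Relation.Unary.Unique.Propositional.Properties using (allFin⁺)
open import Data.List.Relation.Binary.Permutation.Propositional using (↭-sym; ↭⇒↭ₛ)
open import Data.List.Relation.Binary.Permutation.Propositional.Properties using (∈-resp-↭)
open import Data.List.Relation.Binary.Permutation.Setoid.Properties using (Unique-resp-↭)
open import Data.Nat using (zero; suc)
import Data.Nat.Properties as ℕ
open import Data.Product using (Σ; _,_; proj₂)
open import Data.Rational using (_<_; _+_; _*_; _-_; _/_; -_; ½; toℚᵘ)
open import Data.Rational.Properties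
import Data.Rational.Unnormalised as ℚᵘ
import Data.Rational.Unnormalised.Properties as ℚᵘ
open import Data.Sum using (_⊎_; inj₁; inj₂; [_,_])
open import Data.Vec using ([]; _∷_; here; there)
open import Function using (id; _∘_)
open import Relation.Binary.PropositionalEquality
  using (refl; sym; trans; cong; subst; setoid; module ≡-Reasoning)
open import Relation.Nullary using (¬_; contradiction)
open import Relation.Nullary.Decidable using (yes; no; decidable-stable)

open import Algebra.Properties.CommutativeSemigroup
  (CommutativeMonoid.commutativeSemigroup +-0-commutativeMonoid) using (x∙yz≈y∙xz)
open import Algebra.Properties.Group +-0-group using (//-rightDividesˡ; //-rightDividesʳ)
open import Algebra.Properties.Semiring.Mult (CommutativeRing.semiring +-*-commutativeRing)
  using (_×_; ×-comm-*)

×-nonNeg : ∀ {x} → 0ℚ ≤ x → ∀ n → 0ℚ ≤ n × x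
×-nonNeg 0≤x zero = ≤-refl
×-nonNeg 0≤x (suc n) = +-mono-≤ 0≤x (×-nonNeg 0≤x n)

×-monoˡ-≤ : ∀ {x} → 0ℚ ≤ x → ∀ {m n} → m ℕ.≤ n → m × x ≤ n × x
×-monoˡ-≤ 0≤x {n = n} ℕ.z≤n = ×-nonNeg 0≤x n
×-monoˡ-≤ {x} 0≤x (ℕ.s≤s m≤n) = +-monoʳ-≤ x (×-monoˡ-≤ 0≤x m≤n)

p≤p+q : ∀ {p q} → 0ℚ ≤ q → p ≤ p + q
p≤p+q {p} 0≤q = ≤-trans (≤-reflexive (sym (+-identityʳ p))) (+-monoʳ-≤ p 0≤q)

/-+-/ : ∀ i j d .{{_ : NonZero d}} → i / d + j / d ≡ (i ℤ.+ j) / d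
/-+-/ i j D@(suc d) = toℚᵘ-injective (begin
  toℚᵘ (i / D + j / D)                       ≈⟨ toℚᵘ-homo-+ (i / D) (j / D) ⟩
  toℚᵘ (i / D) ℚᵘ.+ toℚᵘ (j / D)             ≈⟨ ℚᵘ.+-cong (toℚᵘ-fromℚᵘ (ℚᵘ.mkℚᵘ i d)) (toℚᵘ-fromℚᵘ (ℚᵘ.mkℚᵘ j d)) ⟩
  (i ℤ.* + D ℤ.+ j ℤ.* + D) ℚᵘ./ (D ℕ.* D)   ≡⟨ cong (ℚᵘ._/ (D ℕ.* D)) (sym (ℤ.*-distribʳ-+ (+ D) i j)) ⟩
  ((i ℤ.+ j) ℤ.* + D) ℚᵘ./ (D ℕ.* D)         ≈⟨ ℚᵘ.*-cancelʳ-/ D ⟩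
  (i ℤ.+ j) ℚᵘ./ D                           ≈⟨ toℚᵘ-fromℚᵘ (ℚᵘ.mkℚᵘ (i ℤ.+ j) d) ⟨
  toℚᵘ ((i ℤ.+ j) / D)                       ∎)
  where open ℚᵘ.≃-Reasoning

×-1/ : ∀ m d .{{_ : NonZero d}} → m × (+ 1 / d) ≡ + m / d
×-1/ zero d = sym (0/n≡0 d)
×-1/ (suc m) d = trans (cong (_+_ (+ 1 / d)) (×-1/ m d)) (/-+-/ (+ 1) (+ m) d)

[1+k]/[2[1+k]]≡½ : ∀ k → + suc k / (2 ℕ.* suc k) ≡ ½
[1+k]/[2[1+k]]≡½ k = fromℚᵘ-cong {+ suc k ℚᵘ./ (2 ℕ.* suc k)} {+ 1 ℚᵘ./ 2} (ℚᵘ.*≡* (begin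
  + suc k ℤ.* + 2          ≡⟨ ℤ.pos-* (suc k) 2 ⟨
  + (suc k ℕ.* 2)          ≡⟨ cong +_ (ℕ.*-comm (suc k) 2) ⟩
  + (2 ℕ.* suc k)          ≡⟨ ℤ.*-identityˡ _ ⟨
  + 1 ℤ.* + (2 ℕ.* suc k)  ∎))
  where open ≡-Reasoning

k×tau≡half : ∀ o k .{{_ : NonZero k}} → k × tau o k ≡ half o
k×tau≡half o (suc k) = begin
  suc k × (o * (+ 1 / (2 ℕ.* suc k)))  ≡⟨ ×-comm-* (suc k) o _ ⟨
  o * (suc k × (+ 1 / (2 ℕ.* suc k)))  ≡⟨ cong (o *_) (×-1/ (suc k) (2 ℕ.* suc k)) ⟩
  o * (+ suc k / (2 ℕ.* suc k))        ≡⟨ cong (o *_) ([1+k]/[2[1+k]]≡½ k) ⟩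
  o * ½                                ≡⟨ *-comm o ½ ⟩
  ½ * o                                ∎
  where open ≡-Reasoning

0≤tau : ∀ {o} k .{{_ : NonZero k}} → 0ℚ ≤ o → 0ℚ ≤ tau o k
0≤tau {o} (suc k) 0≤o = begin
  0ℚ                           ≡⟨ *-zeroˡ r ⟨
  0ℚ * r                       ≤⟨ *-monoʳ-≤-nonNeg r {{normalize-nonNeg 1 (2 ℕ.* suc k)}} 0≤o ⟩
  o * r                        ∎
  where
  r = + 1 / (2 ℕ.* suc k)
  open ≤-Reasoning

half-cancel : ∀ {x s} → x ≤ s + half x → half x ≤ s
half-cancel {x} {s} x≤s+½x = begin
  ½x                 ≡⟨ //-rightDividesʳ ½x ½x ⟨
  ½x + ½x - ½x       ≡⟨ cong (_- ½x) (*-distribʳ-+ x ½ ½) ⟨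
  (½ + ½) * x - ½x   ≡⟨ cong (_- ½x) (*-identityˡ x) ⟩
  x - ½x             ≤⟨ +-monoˡ-≤ (- ½x) x≤s+½x ⟩
  s + ½x - ½x        ≡⟨ //-rightDividesʳ ½x s ⟩
  s                  ∎
  where
  ½x = half x
  open ≤-Reasoning

-- When k ≤ d + 1 the truncated subtraction forces s = 0, and only z < k is left to use.
slack-budget : ∀ s {z d k} → s ℕ.≤ k ∸ (d ℕ.+ 1) → z ℕ.≤ d → suc z ℕ.≤ k → s ℕ.+ z ℕ.+ 1 ℕ.≤ k
slack-budget zero {z} _ _ z<k = ℕ.≤-trans (ℕ.≤-reflexive (ℕ.+-comm z 1)) z<k
slack-budget (suc s) {z} {d} {k} s<k∸[d+1] z≤d _ = begin
  suc s ℕ.+ z ℕ.+ 1     ≡⟨ ℕ.+-assoc (suc s) z 1 ⟩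
  suc s ℕ.+ (z ℕ.+ 1)   ≤⟨ ℕ.+-monoʳ-≤ (suc s) (ℕ.+-monoˡ-≤ 1 z≤d) ⟩
  suc s ℕ.+ (d ℕ.+ 1)   ≤⟨ ℕ.m≤o∸n⇒m+n≤o (suc s) d+1≤k s<k∸[d+1] ⟩
  k                     ∎
  where
  open ℕ.≤-Reasoning
  d+1≤k : d ℕ.+ 1 ℕ.≤ k
  d+1≤k = ℕ.<⇒≤ (ℕ.m∸n≢0⇒n<m (λ k∸[d+1]≡0 → ℕ.n≮0 (subst (s ℕ.<_) k∸[d+1]≡0 s<k∸[d+1])))

∈⇒≤foldr-⊔ : ∀ {A : Set} (g : A → ℕ) {x xs} → x ∈ₗ xs → g x ℕ.≤ foldr (λ y m → g y ℕ.⊔ m) 0 xs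
∈⇒≤foldr-⊔ g (here refl) = ℕ.m≤m⊔n _ _
∈⇒≤foldr-⊔ g (there x∈xs) = ℕ.≤-trans (∈⇒≤foldr-⊔ g x∈xs) (ℕ.m≤n⊔m _ _)

∣Dp∣≤dmax : ∀ {n} (Dp : Fin n → Subset n) u → ∣ Dp u ∣ ℕ.≤ dmax Dp
∣Dp∣≤dmax Dp u = ∈⇒≤foldr-⊔ (λ v → ∣ Dp v ∣) (∈-allFin u)

x∈p─q⇒x∉q : ∀ {n} {x : Fin n} (p q : Subset n) → x ∈ p ─ q → x ∉ q
x∈p─q⇒x∉q (_ ∷ p) (outside ∷ q) here = λ ()
x∈p─q⇒x∉q (_ ∷ p) (_ ∷ q) (there x∈p─q) (there x∈q) = x∈p─q⇒x∉q p q x∈p─q x∈q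

∪-⊆ : ∀ {n} {p q r : Subset n} → p ⊆ r → q ⊆ r → p ∪ q ⊆ r
∪-⊆ {p = p} {q} p⊆r q⊆r x∈p∪q = [ p⊆r , q⊆r ] (x∈p∪q⁻ p q x∈p∪q)

∉-∪ : ∀ {n} {x : Fin n} {p q} → x ∉ p → x ∉ q → x ∉ p ∪ q
∉-∪ {p = p} {q} x∉p x∉q x∈p∪q = [ x∉p , x∉q ] (x∈p∪q⁻ p q x∈p∪q)

x∈p⇒⁅x⁆⊆p : ∀ {n} {x : Fin n} {p} → x ∈ p → ⁅ x ⁆ ⊆ p
x∈p⇒⁅x⁆⊆p {x = x} {p} x∈p y∈⁅x⁆ = subst (_∈ p) (sym (x∈⁅y⁆⇒x≡y x y∈⁅x⁆)) x∈p

∣p∪q∣≤∣p∣+∣q∣ : ∀ {n} (p q : Subset n) → ∣ p ∪ q ∣ ℕ.≤ ∣ p ∣ ℕ.+ ∣ q ∣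
∣p∪q∣≤∣p∣+∣q∣ [] [] = ℕ.z≤n
∣p∪q∣≤∣p∣+∣q∣ (outside ∷ p) (outside ∷ q) = ∣p∪q∣≤∣p∣+∣q∣ p q
∣p∪q∣≤∣p∣+∣q∣ (outside ∷ p) (inside ∷ q) =
  ℕ.≤-trans (ℕ.s≤s (∣p∪q∣≤∣p∣+∣q∣ p q)) (ℕ.≤-reflexive (sym (ℕ.+-suc (∣ p ∣) (∣ q ∣))))
∣p∪q∣≤∣p∣+∣q∣ (inside ∷ p) (outside ∷ q) = ℕ.s≤s (∣p∪q∣≤∣p∣+∣q∣ p q)
∣p∪q∣≤∣p∣+∣q∣ (inside ∷ p) (inside ∷ q) =
  ℕ.s≤s (ℕ.≤-trans (∣p∪q∣≤∣p∣+∣q∣ p q) (ℕ.+-monoʳ-≤ ∣ p ∣ (ℕ.n≤1+n ∣ q ∣)))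

∣p∣+∣q─p∣≡∣q∣ : ∀ {n} {p q : Subset n} → p ⊆ q → ∣ p ∣ ℕ.+ ∣ q ─ p ∣ ≡ ∣ q ∣
∣p∣+∣q─p∣≡∣q∣ {p = []} {[]} _ = refl
∣p∣+∣q─p∣≡∣q∣ {p = outside ∷ p} {outside ∷ q} p⊆q = ∣p∣+∣q─p∣≡∣q∣ (drop-∷-⊆ p⊆q)
∣p∣+∣q─p∣≡∣q∣ {p = outside ∷ p} {inside ∷ q} p⊆q =
  trans (ℕ.+-suc (∣ p ∣) (∣ q ─ p ∣)) (cong suc (∣p∣+∣q─p∣≡∣q∣ (drop-∷-⊆ p⊆q)))
∣p∣+∣q─p∣≡∣q∣ {p = inside ∷ p} {inside ∷ q} p⊆q = cong suc (∣p∣+∣q─p∣≡∣q∣ (drop-∷-⊆ p⊆q))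
∣p∣+∣q─p∣≡∣q∣ {p = inside ∷ p} {outside ∷ q} p⊆q = contradiction (p⊆q here) λ ()

∣p∣+∣q∣≤∣r∣+∣s∣ : ∀ {n} {p q r s : Subset n} → p ⊆ r → q ⊆ (r ─ p) ∪ s →
                  ∣ p ∣ ℕ.+ ∣ q ∣ ℕ.≤ ∣ r ∣ ℕ.+ ∣ s ∣
∣p∣+∣q∣≤∣r∣+∣s∣ {p = p} {q} {r} {s} p⊆r q⊆[r─p]∪s = begin
  ∣ p ∣ ℕ.+ ∣ q ∣                       ≤⟨ ℕ.+-monoʳ-≤ ∣ p ∣ (p⊆q⇒∣p∣≤∣q∣ q⊆[r─p]∪s) ⟩
  ∣ p ∣ ℕ.+ ∣ (r ─ p) ∪ s ∣             ≤⟨ ℕ.+-monoʳ-≤ ∣ p ∣ (∣p∪q∣≤∣p∣+∣q∣ (r ─ p) s) ⟩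
  ∣ p ∣ ℕ.+ (∣ r ─ p ∣ ℕ.+ ∣ s ∣)       ≡⟨ ℕ.+-assoc (∣ p ∣) (∣ r ─ p ∣) (∣ s ∣) ⟨
  (∣ p ∣ ℕ.+ ∣ r ─ p ∣) ℕ.+ ∣ s ∣       ≡⟨ cong (ℕ._+ ∣ s ∣) (∣p∣+∣q─p∣≡∣q∣ p⊆r) ⟩
  ∣ r ∣ ℕ.+ ∣ s ∣                       ∎
  where open ℕ.≤-Reasoning

module _ {n} {f : Subset n → ℚ} {Dp : Fin n → Subset n} (isDplus : IsDplus f Dp) where

  ∉Dplus⇒marg-∪⁅v⁆≤marg : ∀ {u v} → v ∉ Dp u → ∀ T → marg f u (T ∪ ⁅ v ⁆) ≤ marg f u T
  ∉Dplus⇒marg-∪⁅v⁆≤marg {u} {v} v∉Dpu T = ≮⇒≥ (λ raises → v∉Dpu (proj₂ (isDplus u v) (T , raises)))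

  marg-antitone-outside-Dplus : ∀ {u A B} → A ⊆ B → B ∩ Dp u ⊆ A → marg f u B ≤ marg f u A
  marg-antitone-outside-Dplus {u} {A} {B} = go A (⊃-wellFounded A)
    where
    go : ∀ A → Acc _⊃_ A → A ⊆ B → B ∩ Dp u ⊆ A → marg f u B ≤ marg f u A
    go A (acc rec) A⊆B B∩Dpu⊆A with nonempty? (B ─ A)
    ... | no B─A-empty = ≤-reflexive (cong (marg f u) (⊆-antisym B⊆A A⊆B))
      where
      B⊆A : B ⊆ A
      B⊆A {x} x∈B = decidable-stable (x ∈? A) (λ x∉A → B─A-empty (x , x∈p∧x∉q⇒x∈p─q x∈B x∉A))
    ... | yes (v , v∈B─A) = begin
      marg f u B               ≤⟨ go (A ∪ ⁅ v ⁆) (rec A⊂A∪⁅v⁆) (∪-⊆ A⊆B (x∈p⇒⁅x⁆⊆p v∈B)) (p⊆p∪q _ ∘ B∩Dpu⊆A) ⟩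
      marg f u (A ∪ ⁅ v ⁆)     ≤⟨ ∉Dplus⇒marg-∪⁅v⁆≤marg v∉Dpu A ⟩
      marg f u A               ∎
      where
      open ≤-Reasoning
      v∈B : v ∈ B
      v∈B = p─q⊆p B A v∈B─A
      v∉A : v ∉ A
      v∉A = x∈p─q⇒x∉q B A v∈B─A
      v∉Dpu : v ∉ Dp u
      v∉Dpu v∈Dpu = v∉A (B∩Dpu⊆A (x∈p∩q⁺ (v∈B , v∈Dpu)))
      A⊂A∪⁅v⁆ : A ⊂ A ∪ ⁅ v ⁆
      A⊂A∪⁅v⁆ = p⊆p∪q _ , v , q⊆p∪q A ⁅ v ⁆ (x∈⁅x⁆ v) , v∉A

record Pending {n} (P : Subset n) (σ : List (Fin n)) : Set where
  field
    unique   : Unique σ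
    fresh    : ∀ {v} → v ∈ₗ σ → v ∉ P
    complete : ∀ {v} → v ∉ P → v ∈ₗ σ

module _ {n} {P : Subset n} where

  pending-head : ∀ {u σ} → Pending P (u ∷ σ) → u ∉ P
  pending-head pending = Pending.fresh pending (here refl)

  pending-tail : ∀ {u σ} → Pending P (u ∷ σ) → Pending (P ∪ ⁅ u ⁆) σ
  pending-tail {u} {σ} record { unique = u∉σ ∷ unique ; fresh = fresh ; complete = complete } = record
    { unique   = unique
    ; fresh    = λ v∈σ → ∉-∪ (fresh (there v∈σ)) (λ v∈⁅u⁆ → All.lookup u∉σ v∈σ (sym (x∈⁅y⁆⇒x≡y u v∈⁅u⁆)))
    ; complete = tail-complete
    }
    where
    tail-complete : ∀ {v} → v ∉ P ∪ ⁅ u ⁆ → v ∈ₗ σ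
    tail-complete {v} v∉P∪⁅u⁆ with complete (v∉P∪⁅u⁆ ∘ p⊆p∪q _)
    ... | here refl = contradiction (q⊆p∪q P ⁅ v ⁆ (x∈⁅x⁆ v)) v∉P∪⁅u⁆
    ... | there v∈σ = v∈σ

  pending-[] : Pending P [] → ∀ {v} → v ∈ P
  pending-[] pending {v} = decidable-stable (v ∈? P) (λ v∉P → ¬Any[] (Pending.complete pending v∉P))

pending-allFin : ∀ {n} {σ : List (Fin n)} → σ ↭ allFin n → Pending ⊥ σ
pending-allFin {n} σ↭allFin = record
  { unique   = Unique-resp-↭ (setoid (Fin n)) (↭⇒↭ₛ (↭-sym σ↭allFin)) (allFin⁺ n)
  ; fresh    = λ _ → ∉⊥
  ; complete = λ {v} _ → ∈-resp-↭ (↭-sym σ↭allFin) (∈-allFin v)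
  }

module _ {n} {f : Subset n → ℚ} {k : ℕ} {Dp : Fin n → Subset n} {τ : ℚ} where

  Run⇒⊆ : ∀ {P σ S₀ S} → Run f k Dp τ P σ S₀ S → S₀ ⊆ S
  Run⇒⊆ done = id
  Run⇒⊆ (add _ _ run) = Run⇒⊆ run ∘ p⊆p∪q _
  Run⇒⊆ (skip _ run) = Run⇒⊆ run

  Run-fresh : ∀ {P σ S₀ S x} → Run f k Dp τ P σ S₀ S → Pending P σ → x ∈ S → x ∉ S₀ → x ∉ P
  Run-fresh done _ x∈S x∉S₀ = contradiction x∈S x∉S₀
  Run-fresh {x = x} (add {u = u} D (_ , D-fresh , _) run) pending x∈S x∉S₀ with x ∈? (D ∪ ⁅ u ⁆)
  ... | no x∉D∪⁅u⁆ = Run-fresh run (pending-tail pending) x∈S (∉-∪ x∉S₀ x∉D∪⁅u⁆) ∘ p⊆p∪q _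
  ... | yes x∈D∪⁅u⁆ with x∈p∪q⁻ D ⁅ u ⁆ x∈D∪⁅u⁆
  ...   | inj₁ x∈D = D-fresh x x∈D ∘ p⊆p∪q _
  ...   | inj₂ x∈⁅u⁆ with x∈⁅y⁆⇒x≡y u x∈⁅u⁆
  ...     | refl = pending-head pending
  Run-fresh (skip _ run) pending x∈S x∉S₀ = Run-fresh run (pending-tail pending) x∈S x∉S₀ ∘ p⊆p∪q _

module _ {n} {f : Subset n → ℚ} (mono : Monotone f) {k : ℕ} {Dp : Fin n → Subset n}
         (isDplus : IsDplus f Dp) {τ : ℚ} (0≤τ : 0ℚ ≤ τ) {OPT : Subset n} (∣OPT∣≤k : ∣ OPT ∣ ℕ.≤ k) where

  Unseen : Subset n → Subset n
  Unseen P = OPT ─ P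

  UnseenBound : Subset n → Subset n → Set
  UnseenBound P S = f (S ∪ Unseen P) ≤ f S + ∣ Unseen P ∣ × τ

  Fits : Subset n → Set
  Fits S = ∣ S ∣ ℕ.≤ k ∸ (dmax Dp ℕ.+ 1)

  Skipped : Subset n → Fin n → Subset n → Set
  Skipped P u S₀ = ¬ (Σ (Subset n) λ D → Admissible f k Dp τ u (P ∪ ⁅ u ⁆) S₀ D)

  module _ {P : Subset n} {u : Fin n} where

    unseen-∪⁅u⁆⊆unseen : Unseen (P ∪ ⁅ u ⁆) ⊆ Unseen P
    unseen-∪⁅u⁆⊆unseen x∈ = x∈p∧x∉q⇒x∈p─q (p─q⊆p OPT _ x∈) (x∈p─q⇒x∉q OPT _ x∈ ∘ p⊆p∪q _)

    u∉unseen-∪⁅u⁆ : u ∉ Unseen (P ∪ ⁅ u ⁆)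
    u∉unseen-∪⁅u⁆ u∈ = x∈p─q⇒x∉q OPT _ u∈ (q⊆p∪q P ⁅ u ⁆ (x∈⁅x⁆ u))

    unseen⊆unseen-∪⁅u⁆∪⁅u⁆ : Unseen P ⊆ Unseen (P ∪ ⁅ u ⁆) ∪ ⁅ u ⁆
    unseen⊆unseen-∪⁅u⁆∪⁅u⁆ {x} x∈ with x ∈? ⁅ u ⁆
    ... | yes x∈⁅u⁆ = q⊆p∪q _ _ x∈⁅u⁆
    ... | no x∉⁅u⁆ = p⊆p∪q _ (x∈p∧x∉q⇒x∈p─q (p─q⊆p OPT P x∈) (∉-∪ (x∈p─q⇒x∉q OPT P x∈) x∉⁅u⁆))

    settled⇒⊆ : ∀ {S} → u ∈ S ⊎ u ∉ OPT → S ∪ Unseen P ⊆ S ∪ Unseen (P ∪ ⁅ u ⁆)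
    settled⇒⊆ {S} settled {x} x∈ with x∈p∪q⁻ S _ x∈
    ... | inj₁ x∈S = p⊆p∪q _ x∈S
    ... | inj₂ x∈unseen with x∈p∪q⁻ _ ⁅ u ⁆ (unseen⊆unseen-∪⁅u⁆∪⁅u⁆ x∈unseen)
    ...   | inj₁ x∈unseen' = q⊆p∪q S _ x∈unseen'
    ...   | inj₂ x∈⁅u⁆ with x∈⁅y⁆⇒x≡y u x∈⁅u⁆ | settled
    ...     | refl | inj₁ u∈S = p⊆p∪q _ u∈S
    ...     | refl | inj₂ u∉OPT = contradiction (p─q⊆p OPT P x∈unseen) u∉OPT

    bound-step-⊆ : ∀ {S} → S ∪ Unseen P ⊆ S ∪ Unseen (P ∪ ⁅ u ⁆) →
                   UnseenBound (P ∪ ⁅ u ⁆) S → UnseenBound P S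
    bound-step-⊆ {S} ⊆ bound = begin
      f (S ∪ Unseen P)                          ≤⟨ mono _ _ ⊆ ⟩
      f (S ∪ Unseen (P ∪ ⁅ u ⁆))                ≤⟨ bound ⟩
      f S + ∣ Unseen (P ∪ ⁅ u ⁆) ∣ × τ          ≤⟨ +-monoʳ-≤ (f S) (×-monoˡ-≤ 0≤τ (p⊆q⇒∣p∣≤∣q∣ unseen-∪⁅u⁆⊆unseen)) ⟩
      f S + ∣ Unseen P ∣ × τ                    ∎
      where open ≤-Reasoning

    bound-step-marg : ∀ {S} → u ∈ OPT → u ∉ P → marg f u (S ∪ Unseen (P ∪ ⁅ u ⁆)) < τ →
                      UnseenBound (P ∪ ⁅ u ⁆) S → UnseenBound P S
    bound-step-marg {S} u∈OPT u∉P marg<τ bound = begin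
      f (S ∪ Unseen P)                          ≤⟨ mono _ _ S∪unseen⊆W∪⁅u⁆ ⟩
      f (W ∪ ⁅ u ⁆)                             ≡⟨ //-rightDividesˡ (f W) _ ⟨
      marg f u W + f W                          ≤⟨ +-mono-≤ (<⇒≤ marg<τ) bound ⟩
      τ + (f S + m × τ)                         ≡⟨ x∙yz≈y∙xz τ (f S) (m × τ) ⟩
      f S + suc m × τ                           ≤⟨ +-monoʳ-≤ (f S) (×-monoˡ-≤ 0≤τ ∣unseen-∪⁅u⁆∣<∣unseen∣) ⟩
      f S + ∣ Unseen P ∣ × τ                    ∎
      where
      open ≤-Reasoning
      W = S ∪ Unseen (P ∪ ⁅ u ⁆)
      m = ∣ Unseen (P ∪ ⁅ u ⁆) ∣
      S∪unseen⊆W∪⁅u⁆ : S ∪ Unseen P ⊆ W ∪ ⁅ u ⁆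
      S∪unseen⊆W∪⁅u⁆ = ∪-⊆ (p⊆p∪q _ ∘ p⊆p∪q _)
        (∪-⊆ (p⊆p∪q _ ∘ q⊆p∪q S _) (q⊆p∪q _ _) ∘ unseen⊆unseen-∪⁅u⁆∪⁅u⁆)
      ∣unseen-∪⁅u⁆∣<∣unseen∣ : suc m ℕ.≤ ∣ Unseen P ∣
      ∣unseen-∪⁅u⁆∣<∣unseen∣ = p⊂q⇒∣p∣<∣q∣ (unseen-∪⁅u⁆⊆unseen , u , x∈p∧x∉q⇒x∈p─q u∈OPT u∉P , u∉unseen-∪⁅u⁆)

  skipped⇒marg<τ : ∀ {P u σ S₀ S} → Skipped P u S₀ → Run f k Dp τ (P ∪ ⁅ u ⁆) σ S₀ S →
                   Pending (P ∪ ⁅ u ⁆) σ → Fits S → u ∈ OPT → marg f u (S ∪ Unseen (P ∪ ⁅ u ⁆)) < τ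
  skipped⇒marg<τ {P} {u} {σ} {S₀} {S} skipped run pending fits u∈OPT =
    ≰⇒> (λ τ≤marg → skipped (D , p∩q⊆q _ _ , D-fresh , τ≤marg-D∪S₀ τ≤marg , D-fits))
    where
    P' = P ∪ ⁅ u ⁆
    W = S ∪ Unseen P'
    D = (W ─ S₀) ∩ Dp u
    Z = Unseen P' ∩ Dp u

    D⊆[S─S₀]∪Z : D ⊆ (S ─ S₀) ∪ Z
    D⊆[S─S₀]∪Z x∈D with x∈p∩q⁻ (W ─ S₀) _ x∈D
    ... | x∈W─S₀ , x∈Dpu with x∈p∪q⁻ S _ (p─q⊆p W S₀ x∈W─S₀)
    ...   | inj₁ x∈S = p⊆p∪q _ (x∈p∧x∉q⇒x∈p─q x∈S (x∈p─q⇒x∉q W S₀ x∈W─S₀))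
    ...   | inj₂ x∈unseen = q⊆p∪q _ Z (x∈p∩q⁺ (x∈unseen , x∈Dpu))

    D-fresh : ∀ x → x ∈ D → x ∉ P'
    D-fresh x x∈D = [ (λ x∈S─S₀ → Run-fresh run pending (p─q⊆p S S₀ x∈S─S₀) (x∈p─q⇒x∉q S S₀ x∈S─S₀))
                    , x∈p─q⇒x∉q OPT P' ∘ p∩q⊆p _ _ ] (x∈p∪q⁻ _ Z (D⊆[S─S₀]∪Z x∈D))

    W∩Dpu⊆D∪S₀ : W ∩ Dp u ⊆ D ∪ S₀
    W∩Dpu⊆D∪S₀ {x} x∈ with x∈p∩q⁻ W _ x∈ | x ∈? S₀
    ... | _ , _ | yes x∈S₀ = q⊆p∪q D S₀ x∈S₀
    ... | x∈W , x∈Dpu | no x∉S₀ = p⊆p∪q _ (x∈p∩q⁺ (x∈p∧x∉q⇒x∈p─q x∈W x∉S₀ , x∈Dpu))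

    τ≤marg-D∪S₀ : τ ≤ marg f u W → τ ≤ marg f u (D ∪ S₀)
    τ≤marg-D∪S₀ τ≤marg = ≤-trans τ≤marg (marg-antitone-outside-Dplus {f = f} isDplus {u} {D ∪ S₀} {W}
      (∪-⊆ (p─q⊆p W S₀ ∘ p∩q⊆p _ _) (p⊆p∪q _ ∘ Run⇒⊆ run)) W∩Dpu⊆D∪S₀)

    ∣Z∣<∣OPT∣ : suc ∣ Z ∣ ℕ.≤ ∣ OPT ∣
    ∣Z∣<∣OPT∣ = p⊂q⇒∣p∣<∣q∣ (p─q⊆p OPT P' ∘ p∩q⊆p _ _ , u , u∈OPT , u∉unseen-∪⁅u⁆ ∘ p∩q⊆p _ _)

    D-fits : ∣ S₀ ∣ ℕ.+ ∣ D ∣ ℕ.+ 1 ℕ.≤ k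
    D-fits = ℕ.≤-trans (ℕ.+-monoˡ-≤ 1 (∣p∣+∣q∣≤∣r∣+∣s∣ (Run⇒⊆ run) D⊆[S─S₀]∪Z))
      (slack-budget (∣ S ∣) fits (ℕ.≤-trans (∣p∩q∣≤∣q∣ (Unseen P') (Dp u)) (∣Dp∣≤dmax Dp u))
                                 (ℕ.≤-trans ∣Z∣<∣OPT∣ ∣OPT∣≤k))

  unseen-bound : ∀ {P σ S₀ S} → Run f k Dp τ P σ S₀ S → Pending P σ → Fits S → UnseenBound P S
  unseen-bound {P} {S = S} done pending _ = begin
    f (S ∪ Unseen P)          ≤⟨ mono _ _ (∪-⊆ id (λ x∈ → contradiction (pending-[] pending) (x∈p─q⇒x∉q OPT P x∈))) ⟩
    f S                       ≤⟨ p≤p+q (×-nonNeg 0≤τ ∣ Unseen P ∣) ⟩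
    f S + ∣ Unseen P ∣ × τ    ∎
    where open ≤-Reasoning
  unseen-bound (add {u = u} _ _ run) pending fits =
    bound-step-⊆ (settled⇒⊆ (inj₁ (Run⇒⊆ run (q⊆p∪q _ _ (q⊆p∪q _ ⁅ u ⁆ (x∈⁅x⁆ u))))))
      (unseen-bound run (pending-tail pending) fits)
  unseen-bound {S = S} (skip {u = u} skipped run) pending fits with u ∈? S | u ∈? OPT
  ... | yes u∈S | _ = bound-step-⊆ (settled⇒⊆ (inj₁ u∈S)) (unseen-bound run (pending-tail pending) fits)
  ... | no _ | no u∉OPT = bound-step-⊆ (settled⇒⊆ (inj₂ u∉OPT)) (unseen-bound run (pending-tail pending) fits)
  ... | no _ | yes u∈OPT = bound-step-marg u∈OPT (pending-head pending)
    (skipped⇒marg<τ skipped run (pending-tail pending) fits u∈OPT) (unseen-bound run (pending-tail pending) fits)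

lemma10 : (n k : ℕ) .{{_ : NonZero k}} (f : Subset n → ℚ) →
    Monotone f → NonNegative f → f ⊥ ≡ 0ℚ →
    (Dp : Fin n → Subset n) → IsDplus f Dp →
    (OPT : Subset n) → IsOPT f k OPT →
    (opt₂ : ℚ) → half (f OPT) ≤ opt₂ → opt₂ ≤ f OPT →
    (σ : List (Fin n)) → σ ↭ allFin n →
    (S : Subset n) → Run f k Dp (tau opt₂ k) ⊥ σ ⊥ S →
    ∣ S ∣ ℕ.≤ k ∸ (dmax Dp ℕ.+ 1) →
    half (f OPT) ≤ f S
lemma10 n k f mono nonNeg _ Dp isDplus OPT (∣OPT∣≤k , _) opt₂ half-OPT≤opt₂ opt₂≤OPT
        σ σ↭allFin S run fits =
  half-cancel (begin
    f OPT                                ≤⟨ mono _ _ (q⊆p∪q S _ ∘ (λ x∈OPT → x∈p∧x∉q⇒x∈p─q x∈OPT ∉⊥)) ⟩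
    f (S ∪ (OPT ─ ⊥))                    ≤⟨ unseen-bound mono isDplus 0≤τ ∣OPT∣≤k run (pending-allFin σ↭allFin) fits ⟩
    f S + ∣ OPT ─ ⊥ ∣ × τ                ≤⟨ +-monoʳ-≤ (f S) (×-monoˡ-≤ 0≤τ (ℕ.≤-trans (∣p─q∣≤∣p∣ OPT ⊥) ∣OPT∣≤k)) ⟩
    f S + k × τ                          ≡⟨ cong (_+_ (f S)) (k×tau≡half opt₂ k) ⟩
    f S + half opt₂                      ≤⟨ +-monoʳ-≤ (f S) (*-monoˡ-≤-nonNeg ½ opt₂≤OPT) ⟩
    f S + half (f OPT)                   ∎)
  where
  open ≤-Reasoning
  τ = tau opt₂ k
  0≤τ : 0ℚ ≤ τ
  0≤τ = 0≤tau k (≤-trans (*-monoˡ-≤-nonNeg ½ (nonNeg OPT)) half-OPT≤opt₂)
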